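{- Let $n$ be an even positive integer, $0\le k\le n-1$, and let $\xi=a_1a_2\cdots a_{n-1}n$ be a parity alternating permutation of $[n]$ with exactly $k$ ascents whose last entry is $n$. Let $d$ be a positive integer. Then the period of $\xi$ under $\tau$ equals $d$ if and only if the period of $\xi$ under $\sigma$ equals $d(n-k)$.
   Context: Permutations of $[n]=\{1,\dots,n\}$ are written in one-line notation $a_1\cdots a_n$. It is parity alternating if $a_i,a_{i+1}$ have different parities for all $1\le i\le n-1$; an ascent is an index $i$ with $a_i<a_{i+1}$. The operator $\sigma$ on permutations of $[n]$ is defined by: (a) if $n$ is neither $a_1$ nor $a_n$, then $\sigma(a_1\cdots a_n)=b_1\cdots b_n$ with $b_i=a_i+1$, except that the entry $n+1$ is replaced by $1$ in its position; (b) if $a_n=n$, then $\sigma(a_1\cdots a_{n-1}n)=1\,b_1b_2\cdots b_{n-1}$ with $b_i=a_i+1$; (c) if $a_1=n$, then $\sigma(na_1\cdots a_{n-1})=b_1\cdots b_{n-1}\,1$ with $b_i=a_i+1$. For a permutation $\xi=a_1\cdots a_{n-1}n$ with last entry $n$ (called canonical), define $\tau\xi=\sigma^{\,n-a_{n-1}}\xi$ (the $(n-a_{n-1})$-fold application of $\sigma$); this is again canonical. The period of $\xi$ under $\sigma$ (resp. $\tau$) is the smallest positive integer $\ell$ with $\sigma^\ell\xi=\xi$ (resp. $\tau^\ell\xi=\xi$). -}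

module Defs where

open import Data.Nat using (ℕ; zero; suc; _+_; _∸_; _<_; _≤_; _%_; _≟_)
open import Data.List using (List; []; _∷_; _++_; map; upTo; length)
open import Data.Bool using (Bool; true; false; if_then_else_)
open import Data.Product using (_×_)
open import Data.Unit using (⊤)
open import Relation.Nullary using (¬_; does)
open import Relation.Binary.PropositionalEquality using (_≡_)
open import Data.List.Relation.Binary.Permutation.Propositional using (_↭_)

IsPerm : ℕ → List ℕ → Set
IsPerm n xs = xs ↭ map suc (upTo n)

ParityAlternating : List ℕ → Set
ParityAlternating [] = ⊤
ParityAlternating (x ∷ []) = ⊤
ParityAlternating (x ∷ y ∷ xs) = ¬ (x % 2 ≡ y % 2) × ParityAlternating (y ∷ xs)

asc : List ℕ → ℕ
asc [] = 0
asc (x ∷ []) = 0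
asc (x ∷ y ∷ xs) = (if does (suc x Data.Nat.≤? y) then 1 else 0) + asc (y ∷ xs)

lastIs : ℕ → List ℕ → Bool
lastIs n [] = false
lastIs n (x ∷ []) = does (x ≟ n)
lastIs n (x ∷ y ∷ xs) = lastIs n (y ∷ xs)

init : List ℕ → List ℕ
init [] = []
init (x ∷ []) = []
init (x ∷ y ∷ xs) = x ∷ init (y ∷ xs)

-- second-to-last entry a_{n-1} (default 0 for lists of length < 2)
secondLast : List ℕ → ℕ
secondLast [] = 0
secondLast (x ∷ []) = 0
secondLast (x ∷ y ∷ []) = x
secondLast (x ∷ y ∷ z ∷ xs) = secondLast (y ∷ z ∷ xs)

σ : ℕ → List ℕ → List ℕ
σ n xs with lastIs n xs
... | true = 1 ∷ map suc (init xs)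
σ n [] | false = []
σ n (x ∷ xs) | false with does (x ≟ n)
... | true = map suc xs ++ (1 ∷ [])
... | false = map (λ a → if does (a ≟ n) then 1 else suc a) (x ∷ xs)

iter : (List ℕ → List ℕ) → ℕ → List ℕ → List ℕ
iter f zero xs = xs
iter f (suc m) xs = f (iter f m xs)

τ : ℕ → List ℕ → List ℕ
τ n ξ = iter (σ n) (n ∸ secondLast ξ) ξ

IsPeriod : (List ℕ → List ℕ) → List ℕ → ℕ → Set
IsPeriod f ξ ℓ = (0 < ℓ) × (iter f ℓ ξ ≡ ξ) × (∀ m → 0 < m → m < ℓ → ¬ (iter f m ξ ≡ ξ))

-- For canonical ξ = a₁ ⋯ a_{n−1} n, the first σ-step moves the final n to the front and every
-- further step adds 1 (mod n) to each entry, until after n − a_{n−1} steps n is last again.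
-- Hence τ rotates by one place the cyclic gaps of the closed walk n → a₁ → ⋯ → a_{n−1} → n,
-- and the gap moved to the front is the number of σ-steps used. The gaps sum to n(n − k),
-- a full turn for each of the n − k descents. A rotation changes the weighted sum
-- Σ (distance from the end) · gap by (sum of gaps) − n · (moved gap), so if τʲ ξ = ξ then the
-- σ-time spent is j(n − k). Canonical permutations occur in the σ-orbit only at these
-- return times, so τ-periods d and σ-periods d(n − k) correspond.
module Submission where

open import Defs
open import Relation.Binary.PropositionalEquality
open import Data.Bool using (true; false; if_then_else_)
open import Data.Empty using (⊥-elim)
open import Data.List using (List; []; _∷_; _++_; _∷ʳ_; map; length; upTo; initLast; _∷ʳ′_)
open import Data.List.Membership.Propositional.Properties using (∈-upTo⁻)
open import Data.List.Properties using (length-++; length-map; length-upTo; map-++; map-∘; map-cong-local)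
open import Data.List.Relation.Binary.Permutation.Propositional using (_↭_; ↭-sym; ↭⇒↭ₛ)
open import Data.List.Relation.Binary.Permutation.Propositional.Properties using (All-resp-↭; ↭-length; ∷↭∷ʳ)
open import Data.List.Relation.Unary.All using (All; []; _∷_)
import Data.List.Relation.Unary.All as All
import Data.List.Relation.Unary.All.Properties as All
open import Data.List.Relation.Unary.AllPairs using (AllPairs; []; _∷_)
import Data.List.Relation.Unary.AllPairs as AllPairs
open import Data.List.Relation.Unary.Linked using (Linked; []; [-]; _∷_)
open import Data.List.Relation.Unary.Linked.Properties using (AllPairs⇒Linked)
import Data.List.Relation.Unary.Unique.Propositional.Properties as Unique
open import Data.Nat using (ℕ; zero; suc; _+_; _*_; _∸_; _<_; _≤_; z≤n; s≤s; _≟_; _≤?_; _<?_; NonZero; >-nonZero)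
open import Data.Nat.Divisibility using (_∣_; ∣⇒≤)
open import Data.Nat.ListAction using (sum)
open import Data.Nat.ListAction.Properties using (sum-++)
open import Data.Nat.Properties
open import Data.Nat.Tactic.RingSolver using (solve-∀)
open import Data.Product using (_×_; _,_; proj₁; proj₂; ∃; ∃₂)
open import Data.Sum using (inj₁; inj₂)
open import Function using (_∘_)
open import Function.Bundles using (_⇔_; mk⇔)
open import Relation.Nullary using (¬_; does; yes; no; contradiction)
open import Relation.Nullary.Decidable using (dec-true; dec-false)
open import Data.List.Relation.Binary.Permutation.Setoid.Properties (setoid ℕ) using (Unique-resp-↭)
open import Algebra.Properties.CommutativeSemigroup +-commutativeSemigroup
  using () renaming (x∙yz≈y∙xz to m+[n+o]≡n+[m+o])
open import Algebra.Properties.CommutativeSemigroup *-commutativeSemigroup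
  using () renaming (x∙yz≈y∙xz to m*[n*o]≡n*[m*o])

lastOf : ∀ {A : Set} → A → List A → A
lastOf x []      = x
lastOf x (y ∷ r) = lastOf y r

lastOf-∷ʳ : ∀ {A : Set} (x : A) r z → lastOf x (r ∷ʳ z) ≡ z
lastOf-∷ʳ x []      z = refl
lastOf-∷ʳ x (y ∷ r) z = lastOf-∷ʳ y r z

length-∷ʳ : ∀ {A : Set} (xs : List A) x → length (xs ∷ʳ x) ≡ suc (length xs)
length-∷ʳ xs x = trans (length-++ xs) (+-comm (length xs) 1)

∷-∷ʳ-view : ∀ {A : Set} (x : A) xs → ∃₂ λ ys y → x ∷ xs ≡ ys ∷ʳ y
∷-∷ʳ-view x []       = [] , x , refl
∷-∷ʳ-view x (y ∷ xs) with ∷-∷ʳ-view y xs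
... | ys , z , eq = x ∷ ys , z , cong (x ∷_) eq

map-distinct : ∀ {A B : Set} {P : A → Set} {f : A → B} →
               (∀ {x y} → P x → P y → f x ≡ f y → x ≡ y) →
               ∀ {xs} → All P xs → AllPairs _≢_ xs → AllPairs _≢_ (map f xs)
map-distinct inj []         []           = []
map-distinct inj (px ∷ pxs) (x∉xs ∷ xs!) =
  All.map⁺ (All.zipWith (λ (py , x≢y) → x≢y ∘ inj px py) (pxs , x∉xs)) ∷ map-distinct inj pxs xs!

distinct-resp-↭ : ∀ {xs ys : List ℕ} → xs ↭ ys → AllPairs _≢_ xs → AllPairs _≢_ ys
distinct-resp-↭ xs↭ys = Unique-resp-↭ (↭⇒↭ₛ xs↭ys)

lastIs-∷ʳ : ∀ n xs z → lastIs n (xs ∷ʳ z) ≡ does (z ≟ n)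
lastIs-∷ʳ n []           z = refl
lastIs-∷ʳ n (x ∷ [])     z = refl
lastIs-∷ʳ n (x ∷ y ∷ xs) z = lastIs-∷ʳ n (y ∷ xs) z

init-∷ʳ : ∀ xs (z : ℕ) → init (xs ∷ʳ z) ≡ xs
init-∷ʳ []           z = refl
init-∷ʳ (x ∷ [])     z = refl
init-∷ʳ (x ∷ y ∷ xs) z = cong (x ∷_) (init-∷ʳ (y ∷ xs) z)

secondLast-∷ʳ : ∀ xs (b z : ℕ) → secondLast (xs ∷ʳ b ∷ʳ z) ≡ b
secondLast-∷ʳ []               b z = refl
secondLast-∷ʳ (x ∷ [])         b z = refl
secondLast-∷ʳ (x ∷ y ∷ [])     b z = refl
secondLast-∷ʳ (x ∷ y ∷ w ∷ xs) b z = secondLast-∷ʳ (y ∷ w ∷ xs) b z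

iter-+ : ∀ (f : List ℕ → List ℕ) a b x → iter f (a + b) x ≡ iter f a (iter f b x)
iter-+ f zero    b x = refl
iter-+ f (suc a) b x = cong f (iter-+ f a b x)

-- The cyclic successor on [n]

InRange : ℕ → ℕ → Set
InRange n x = 0 < x × x ≤ n

cyc : ℕ → ℕ → ℕ
cyc n a = if does (a ≟ n) then 1 else suc a

cyc^ : ℕ → ℕ → ℕ → ℕ
cyc^ n zero    a = a
cyc^ n (suc m) a = cyc n (cyc^ n m a)

module _ {n : ℕ} where

  cyc-≡ : ∀ {a} → a ≡ n → cyc n a ≡ 1
  cyc-≡ {a} a≡n = cong (if_then 1 else suc a) (dec-true (a ≟ n) a≡n)

  cyc-≢ : ∀ {a} → a ≢ n → cyc n a ≡ suc a
  cyc-≢ {a} a≢n = cong (if_then 1 else suc a) (dec-false (a ≟ n) a≢n)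

  cyc-inRange : ∀ {a} → InRange n a → InRange n (cyc n a)
  cyc-inRange {a} (0<a , a≤n) with a ≟ n
  ... | yes a≡n = subst (InRange n) (sym (cyc-≡ a≡n)) (s≤s z≤n , ≤-trans 0<a a≤n)
  ... | no  a≢n = subst (InRange n) (sym (cyc-≢ a≢n)) (s≤s z≤n , ≤∧≢⇒< a≤n a≢n)

  cyc-injective : ∀ {a b} → 0 < a → 0 < b → cyc n a ≡ cyc n b → a ≡ b
  cyc-injective {a} {b} 0<a 0<b eq with a ≟ n | b ≟ n
  ... | yes a≡n | yes b≡n = trans a≡n (sym b≡n)
  ... | yes a≡n | no  b≢n = ⊥-elim (<⇒≢ 0<b (suc-injective (trans (sym (cyc-≡ a≡n)) (trans eq (cyc-≢ b≢n)))))
  ... | no  a≢n | yes b≡n = ⊥-elim (<⇒≢ 0<a (suc-injective (trans (sym (cyc-≡ b≡n)) (trans (sym eq) (cyc-≢ a≢n)))))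
  ... | no  a≢n | no  b≢n = suc-injective (trans (sym (cyc-≢ a≢n)) (trans eq (cyc-≢ b≢n)))

  cyc^-inRange : ∀ m {a} → InRange n a → InRange n (cyc^ n m a)
  cyc^-inRange zero    a∈ = a∈
  cyc^-inRange (suc m) a∈ = cyc-inRange (cyc^-inRange m a∈)

  cyc^-injective : ∀ m {a b} → InRange n a → InRange n b → cyc^ n m a ≡ cyc^ n m b → a ≡ b
  cyc^-injective zero    _  _  eq = eq
  cyc^-injective (suc m) a∈ b∈ eq = cyc^-injective m a∈ b∈
    (cyc-injective (proj₁ (cyc^-inRange m a∈)) (proj₁ (cyc^-inRange m b∈)) eq)

  cyc^-+ : ∀ m {a} → a + m ≤ n → cyc^ n m a ≡ a + m
  cyc^-+ zero    {a} _   = sym (+-identityʳ a)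
  cyc^-+ (suc m) {a} a+1+m≤n = begin
    cyc n (cyc^ n m a) ≡⟨ cong (cyc n) (cyc^-+ m (<⇒≤ a+m<n′)) ⟩
    cyc n (a + m)      ≡⟨ cyc-≢ (<⇒≢ a+m<n′) ⟩
    suc (a + m)        ≡⟨ +-suc a m ⟨
    a + suc m          ∎
    where
    open ≡-Reasoning
    a+m<n′ : a + m < n
    a+m<n′ = subst (_≤ n) (+-suc a m) a+1+m≤n

  cyc^-from-n : ∀ m → m < n → cyc^ n (suc m) n ≡ suc m
  cyc^-from-n zero    _   = cyc-≡ refl
  cyc^-from-n (suc m) m<n = trans (cong (cyc n) (cyc^-from-n m (<⇒≤ m<n))) (cyc-≢ (<⇒≢ m<n))


-- Cyclic gaps

ascent : ℕ → ℕ → ℕ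
ascent x y = if does (suc x ≤? y) then 1 else 0

ascent-< : ∀ {x y} → x < y → ascent x y ≡ 1
ascent-< {x} {y} x<y = cong (if_then 1 else 0) (dec-true (suc x ≤? y) x<y)

ascent-≮ : ∀ {x y} → ¬ x < y → ascent x y ≡ 0
ascent-≮ {x} {y} x≮y = cong (if_then 1 else 0) (dec-false (suc x ≤? y) x≮y)

-- the number of steps of cyc n from x to y (n steps when x = y)
gap : ℕ → ℕ → ℕ → ℕ
gap n x y = if does (suc x ≤? y) then y ∸ x else (y + n) ∸ x

module _ {n : ℕ} where

  gap-< : ∀ {x y} → x < y → gap n x y ≡ y ∸ x
  gap-< {x} {y} x<y = cong (if_then y ∸ x else (y + n) ∸ x) (dec-true (suc x ≤? y) x<y)

  gap-≮ : ∀ {x y} → ¬ x < y → gap n x y ≡ (y + n) ∸ x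
  gap-≮ {x} {y} x≮y = cong (if_then y ∸ x else (y + n) ∸ x) (dec-false (suc x ≤? y) x≮y)

  gap-ascent : ∀ {x y} → x ≤ n → gap n x y + x + n * ascent x y ≡ y + n
  gap-ascent {x} {y} x≤n with x <? y
  ... | yes x<y = begin
    gap n x y + x + n * ascent x y ≡⟨ cong₂ (λ g a → g + x + n * a) (gap-< x<y) (ascent-< x<y) ⟩
    y ∸ x + x + n * 1              ≡⟨ cong₂ _+_ (m∸n+n≡m (<⇒≤ x<y)) (*-identityʳ n) ⟩
    y + n                          ∎
    where open ≡-Reasoning
  ... | no x≮y = begin
    gap n x y + x + n * ascent x y ≡⟨ cong₂ (λ g a → g + x + n * a) (gap-≮ x≮y) (ascent-≮ x≮y) ⟩
    (y + n) ∸ x + x + n * 0        ≡⟨ cong₂ _+_ (m∸n+n≡m (≤-trans x≤n (m≤n+m n y))) (*-zeroʳ n) ⟩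
    y + n + 0                      ≡⟨ +-identityʳ (y + n) ⟩
    y + n                          ∎
    where open ≡-Reasoning

  gap-cyc : ∀ {x y} → InRange n x → InRange n y → x ≢ y → gap n (cyc n x) (cyc n y) ≡ gap n x y
  gap-cyc {x} {y} (_ , x≤n) (0<y , y≤n) x≢y with x ≟ n | y ≟ n
  ... | yes x≡n | yes y≡n = ⊥-elim (x≢y (trans x≡n (sym y≡n)))
  ... | yes refl | no y≢n = begin
    gap n (cyc n n) (cyc n y) ≡⟨ cong₂ (gap n) (cyc-≡ refl) (cyc-≢ y≢n) ⟩
    gap n 1 (suc y)           ≡⟨ gap-< (s≤s 0<y) ⟩
    y                         ≡⟨ m+n∸n≡m y n ⟨
    (y + n) ∸ n               ≡⟨ gap-≮ (λ n<y → <⇒≱ n<y y≤n) ⟨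
    gap n n y                 ∎
    where open ≡-Reasoning
  ... | no x≢n | yes refl = begin
    gap n (cyc n x) (cyc n n) ≡⟨ cong₂ (gap n) (cyc-≢ x≢n) (cyc-≡ refl) ⟩
    gap n (suc x) 1           ≡⟨ gap-≮ {x = suc x} {y = 1} (λ { (s≤s ()) }) ⟩
    (1 + n) ∸ suc x           ≡⟨ gap-< (≤∧≢⇒< x≤n x≢n) ⟨
    gap n x n                 ∎
    where open ≡-Reasoning
  ... | no x≢n | no y≢n = cong₂ (gap n) (cyc-≢ {a = x} x≢n) (cyc-≢ {a = y} y≢n)

  gap-cyc^ : ∀ m {x y} → InRange n x → InRange n y → x ≢ y →
             gap n (cyc^ n m x) (cyc^ n m y) ≡ gap n x y
  gap-cyc^ zero    _  _  _   = refl
  gap-cyc^ (suc m) x∈ y∈ x≢y = trans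
    (gap-cyc (cyc^-inRange m x∈) (cyc^-inRange m y∈) (x≢y ∘ cyc^-injective m x∈ y∈))
    (gap-cyc^ m x∈ y∈ x≢y)

gaps : ℕ → List ℕ → List ℕ
gaps n (x ∷ y ∷ r) = gap n x y ∷ gaps n (y ∷ r)
gaps n _           = []

module _ {n : ℕ} where

  length-gaps : ∀ x r → length (gaps n (x ∷ r)) ≡ length r
  length-gaps x []      = refl
  length-gaps x (y ∷ r) = cong suc (length-gaps y r)

  gaps-∷ʳ : ∀ x r z → gaps n (x ∷ r ∷ʳ z) ≡ gaps n (x ∷ r) ∷ʳ gap n (lastOf x r) z
  gaps-∷ʳ x []      z = refl
  gaps-∷ʳ x (y ∷ r) z = cong (gap n x y ∷_) (gaps-∷ʳ y r z)

  gaps-map-cyc^ : ∀ m {L} → All (InRange n) L → Linked _≢_ L →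
                  gaps n (map (cyc^ n m) L) ≡ gaps n L
  gaps-map-cyc^ m []                 []          = refl
  gaps-map-cyc^ m (_ ∷ [])           [-]         = refl
  gaps-map-cyc^ m (x∈ ∷ y∈ ∷ L∈) (x≢y ∷ L≢) =
    cong₂ _∷_ (gap-cyc^ m x∈ y∈ x≢y) (gaps-map-cyc^ m (y∈ ∷ L∈) L≢)

  sum-gaps-asc : ∀ x r → All (_≤ n) (x ∷ r) →
                 sum (gaps n (x ∷ r)) + x + n * asc (x ∷ r) ≡ lastOf x r + n * length r
  sum-gaps-asc x []      _              = refl
  sum-gaps-asc x (y ∷ r) (x≤n ∷ r≤n) = begin
    (gap n x y + S) + x + n * (ascent x y + A) ≡⟨ regroup n (gap n x y) S x (ascent x y) A ⟩
    (gap n x y + x + n * ascent x y) + (S + n * A) ≡⟨ cong (_+ (S + n * A)) (gap-ascent {y = y} x≤n) ⟩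
    (y + n) + (S + n * A)                        ≡⟨ shift n y S A ⟩
    (S + y + n * A) + n                          ≡⟨ cong (_+ n) (sum-gaps-asc y r r≤n) ⟩
    (lastOf y r + n * length r) + n              ≡⟨ +-assoc (lastOf y r) (n * length r) n ⟩
    lastOf y r + (n * length r + n)              ≡⟨ cong (lastOf y r +_) (+-comm (n * length r) n) ⟩
    lastOf y r + (n + n * length r)              ≡⟨ cong (lastOf y r +_) (*-suc n (length r)) ⟨
    lastOf y r + n * suc (length r)              ∎
    where
    open ≡-Reasoning
    S = sum (gaps n (y ∷ r))
    A = asc (y ∷ r)
    regroup : ∀ n g S x a A → (g + S) + x + n * (a + A) ≡ (g + x + n * a) + (S + n * A)
    regroup = solve-∀
    shift : ∀ n y S A → (y + n) + (S + n * A) ≡ (S + y + n * A) + n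
    shift = solve-∀

asc-∷-max : ∀ x ys → All (_≤ x) ys → asc (x ∷ ys) ≡ asc ys
asc-∷-max x []       _           = refl
asc-∷-max x (y ∷ ys) (y≤x ∷ _) = cong (_+ asc (y ∷ ys)) (ascent-≮ (≤⇒≯ y≤x))

sum-gaps-closed : ∀ n ξ → All (_≤ n) ξ → lastOf n ξ ≡ n → length ξ ≡ n →
                  sum (gaps n (n ∷ ξ)) ≡ n * (n ∸ asc ξ)
sum-gaps-closed n ξ ξ≤n last≡n length≡n = begin
  S                 ≡⟨ m+n∸n≡m S (n * asc ξ) ⟨
  S + n * asc ξ ∸ n * asc ξ ≡⟨ cong (_∸ n * asc ξ) S+nk≡n*n ⟩
  n * n ∸ n * asc ξ ≡⟨ *-distribˡ-∸ n n (asc ξ) ⟨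
  n * (n ∸ asc ξ)   ∎
  where
  open ≡-Reasoning
  S = sum (gaps n (n ∷ ξ))
  S+nk≡n*n : S + n * asc ξ ≡ n * n
  S+nk≡n*n = +-cancelˡ-≡ n _ _ (begin
    n + (S + n * asc ξ)       ≡⟨ trans (cong (_+ n * asc ξ) (+-comm S n)) (+-assoc n S _) ⟨
    S + n + n * asc ξ         ≡⟨ cong (λ a → S + n + n * a) (asc-∷-max n ξ ξ≤n) ⟨
    S + n + n * asc (n ∷ ξ)   ≡⟨ sum-gaps-asc n ξ (≤-refl ∷ ξ≤n) ⟩
    lastOf n ξ + n * length ξ ≡⟨ cong₂ (λ l m → l + n * m) last≡n length≡n ⟩
    n + n * n                 ∎)

weightedSum : List ℕ → ℕ
weightedSum []       = 0
weightedSum (x ∷ xs) = length xs * x + weightedSum xs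

weightedSum-∷ʳ : ∀ xs p → weightedSum (xs ∷ʳ p) ≡ weightedSum xs + sum xs
weightedSum-∷ʳ []       p = refl
weightedSum-∷ʳ (x ∷ xs) p = begin
  length (xs ∷ʳ p) * x + weightedSum (xs ∷ʳ p)
    ≡⟨ cong₂ (λ l w → l * x + w) (length-++ xs) (weightedSum-∷ʳ xs p) ⟩
  (length xs + 1) * x + (weightedSum xs + sum xs)
    ≡⟨ regroup (length xs) x (weightedSum xs) (sum xs) ⟩
  (length xs * x + weightedSum xs) + (x + sum xs) ∎
  where
  open ≡-Reasoning
  regroup : ∀ l x w s → (l + 1) * x + (w + s) ≡ (l * x + w) + (x + s)
  regroup = solve-∀

weightedSum-rotate : ∀ xs p →
  suc (length xs) * p + weightedSum (xs ∷ʳ p) ≡ sum (xs ∷ʳ p) + weightedSum (p ∷ xs)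
weightedSum-rotate xs p = begin
  suc (length xs) * p + weightedSum (xs ∷ʳ p)
    ≡⟨ cong (suc (length xs) * p +_) (weightedSum-∷ʳ xs p) ⟩
  suc (length xs) * p + (weightedSum xs + sum xs)
    ≡⟨ regroup (length xs) p (weightedSum xs) (sum xs) ⟩
  (sum xs + (p + 0)) + (length xs * p + weightedSum xs)
    ≡⟨ cong (_+ weightedSum (p ∷ xs)) (sum-++ xs (p ∷ [])) ⟨
  sum (xs ∷ʳ p) + weightedSum (p ∷ xs) ∎
  where
  open ≡-Reasoning
  regroup : ∀ l p w s → (1 + l) * p + (w + s) ≡ (s + (p + 0)) + (l * p + w)
  regroup = solve-∀

-- The σ-orbit of a canonical permutation

σ-last-n : ∀ {n} xs → lastIs n xs ≡ true → σ n xs ≡ 1 ∷ map suc (init xs)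
σ-last-n xs last≡n rewrite last≡n = refl

σ-interior : ∀ {n x} xs → lastIs n (x ∷ xs) ≡ false → x ≢ n → σ n (x ∷ xs) ≡ map (cyc n) (x ∷ xs)
σ-interior {n} {x} xs last≢n x≢n rewrite last≢n | dec-false (x ≟ n) x≢n =
  cong (λ c → (if c then 1 else suc x) ∷ map (cyc n) xs) (dec-false (x ≟ n) x≢n)

-- es ∷ʳ b ∷ʳ n is a₁ ⋯ a_{n−1} n, so b = a_{n−1}.
data Canonical (n : ℕ) : List ℕ → Set where
  canonical : ∀ es b → suc (suc (length es)) ≡ n →
              AllPairs _≢_ (n ∷ es ∷ʳ b) → All (InRange n) (es ∷ʳ b) →
              Canonical n (es ∷ʳ b ∷ʳ n)

module Orbit {n : ℕ} {es : List ℕ} {b : ℕ}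
             (distinct : AllPairs _≢_ (n ∷ es ∷ʳ b)) (inRange : All (InRange n) (es ∷ʳ b)) where

  ξ : List ℕ
  ξ = es ∷ʳ b ∷ʳ n

  L : List ℕ
  L = n ∷ es ∷ʳ b

  b∈ : InRange n b
  b∈ = proj₂ (All.∷ʳ⁻ inRange)

  b≢n : b ≢ n
  b≢n = proj₂ (All.∷ʳ⁻ (AllPairs.head distinct)) ∘ sym

  b<n : b < n
  b<n = ≤∧≢⇒< (proj₂ b∈) b≢n

  L∈ : All (InRange n) L
  L∈ = (≤-trans (proj₁ b∈) (proj₂ b∈) , ≤-refl) ∷ inRange

  b+<n : ∀ {k} → k < n ∸ b → b + k < n
  b+<n {k} k<n-b = begin-strict
    b + k       <⟨ +-monoʳ-< b k<n-b ⟩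
    b + (n ∸ b) ≡⟨ m+[n∸m]≡n (<⇒≤ b<n) ⟩
    n           ∎
    where open ≤-Reasoning

  cyc^-b : cyc^ n (n ∸ b) b ≡ n
  cyc^-b = trans (cyc^-+ (n ∸ b) (≤-reflexive b+n-b≡n)) b+n-b≡n
    where
    b+n-b≡n : b + (n ∸ b) ≡ n
    b+n-b≡n = m+[n∸m]≡n (<⇒≤ b<n)

  lastIs-ξ : lastIs n ξ ≡ true
  lastIs-ξ = trans (lastIs-∷ʳ n (es ∷ʳ b) n) (dec-true (n ≟ n) refl)

  lastIs-orbit : ∀ k → b + k < n → lastIs n (map (cyc^ n k) L) ≡ false
  lastIs-orbit k b+k<n = begin
    lastIs n (map (cyc^ n k) L)                      ≡⟨ cong (lastIs n) (map-++ (cyc^ n k) (n ∷ es) (b ∷ [])) ⟩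
    lastIs n (map (cyc^ n k) (n ∷ es) ∷ʳ cyc^ n k b) ≡⟨ lastIs-∷ʳ n (map (cyc^ n k) (n ∷ es)) (cyc^ n k b) ⟩
    does (cyc^ n k b ≟ n)                            ≡⟨ cong (λ a → does (a ≟ n)) (cyc^-+ k (<⇒≤ b+k<n)) ⟩
    does (b + k ≟ n)                                 ≡⟨ dec-false (b + k ≟ n) (<⇒≢ b+k<n) ⟩
    false                                            ∎
    where open ≡-Reasoning

  σ^-ξ : ∀ k → 0 < k → k ≤ n ∸ b → iter (σ n) k ξ ≡ map (cyc^ n k) L
  σ^-ξ (suc zero) _ _ = begin
    σ n ξ                      ≡⟨ σ-last-n ξ lastIs-ξ ⟩
    1 ∷ map suc (init ξ)       ≡⟨ cong (λ ys → 1 ∷ map suc ys) (init-∷ʳ (es ∷ʳ b) n) ⟩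
    1 ∷ map suc (es ∷ʳ b)      ≡⟨ cong₂ _∷_ (cyc-≡ refl) suc≗cyc ⟨
    map (cyc n) L              ∎
    where
    open ≡-Reasoning
    suc≗cyc : map (cyc n) (es ∷ʳ b) ≡ map suc (es ∷ʳ b)
    suc≗cyc = map-cong-local (All.map (λ n≢a → cyc-≢ (n≢a ∘ sym)) (AllPairs.head distinct))
  σ^-ξ (suc (suc m)) _ k<n-b = begin
    σ n (iter (σ n) (suc m) ξ)           ≡⟨ cong (σ n) (σ^-ξ (suc m) (s≤s z≤n) (<⇒≤ k<n-b)) ⟩
    σ n (map (cyc^ n (suc m)) L)         ≡⟨ σ-interior _ (lastIs-orbit (suc m) (b+<n k<n-b)) head≢n ⟩
    map (cyc n) (map (cyc^ n (suc m)) L) ≡⟨ map-∘ L ⟨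
    map (cyc^ n (suc (suc m))) L         ∎
    where
    open ≡-Reasoning
    m<n : suc m < n
    m<n = ≤-trans k<n-b (m∸n≤m n b)
    head≢n : cyc^ n (suc m) n ≢ n
    head≢n = <⇒≢ (subst (_< n) (sym (cyc^-from-n m (<⇒≤ m<n))) m<n)

  lastIs-σ^-ξ : ∀ m → 0 < m → m < n ∸ b → lastIs n (iter (σ n) m ξ) ≡ false
  lastIs-σ^-ξ m 0<m m<n-b =
    trans (cong (lastIs n) (σ^-ξ m 0<m (<⇒≤ m<n-b))) (lastIs-orbit m (b+<n m<n-b))

  secondLast-ξ : secondLast ξ ≡ b
  secondLast-ξ = secondLast-∷ʳ es b n

  τ-ξ : τ n ξ ≡ map (cyc^ n (n ∸ b)) L
  τ-ξ = begin
    iter (σ n) (n ∸ secondLast ξ) ξ ≡⟨ cong (λ s → iter (σ n) (n ∸ s) ξ) secondLast-ξ ⟩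
    iter (σ n) (n ∸ b) ξ            ≡⟨ σ^-ξ (n ∸ b) (m<n⇒0<n∸m b<n) ≤-refl ⟩
    map (cyc^ n (n ∸ b)) L          ∎
    where open ≡-Reasoning

  map-cyc^-L : map (cyc^ n (n ∸ b)) L ≡ map (cyc^ n (n ∸ b)) (n ∷ es) ∷ʳ n
  map-cyc^-L = trans (map-++ (cyc^ n (n ∸ b)) (n ∷ es) (b ∷ []))
                     (cong (λ z → map (cyc^ n (n ∸ b)) (n ∷ es) ∷ʳ z) cyc^-b)

  τ-canonical : suc (suc (length es)) ≡ n → Canonical n (τ n ξ)
  τ-canonical length≡n with ∷-∷ʳ-view (cyc^ n (n ∸ b) n) (map (cyc^ n (n ∸ b)) es)
  ... | es′ , b′ , eq = subst (Canonical n) (sym τ≡) (canonical es′ b′ length′ distinct′ inRange′)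
    where
    τ≡ : τ n ξ ≡ es′ ∷ʳ b′ ∷ʳ n
    τ≡ = trans τ-ξ (trans map-cyc^-L (cong (_∷ʳ n) eq))
    length′ : suc (suc (length es′)) ≡ n
    length′ = trans (cong suc (begin
      suc (length es′)                         ≡⟨ length-∷ʳ es′ b′ ⟨
      length (es′ ∷ʳ b′)                       ≡⟨ cong length eq ⟨
      suc (length (map (cyc^ n (n ∸ b)) es))   ≡⟨ cong suc (length-map _ es) ⟩
      suc (length es)                          ∎)) length≡n
      where open ≡-Reasoning
    distinct′ : AllPairs _≢_ (n ∷ es′ ∷ʳ b′)
    distinct′ = distinct-resp-↭ (↭-sym (∷↭∷ʳ n (es′ ∷ʳ b′)))
      (subst (AllPairs _≢_) (trans (sym τ-ξ) τ≡) (map-distinct (cyc^-injective (n ∸ b)) L∈ distinct))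
    inRange′ : All (InRange n) (es′ ∷ʳ b′)
    inRange′ = subst (All (InRange n)) eq
      (All.map⁺ (All.map (cyc^-inRange (n ∸ b)) (All.head L∈ ∷ proj₁ (All.∷ʳ⁻ inRange))))

  gaps-ξ : gaps n (n ∷ ξ) ≡ gaps n L ∷ʳ (n ∸ b)
  gaps-ξ = begin
    gaps n (n ∷ ξ)                                  ≡⟨ gaps-∷ʳ n (es ∷ʳ b) n ⟩
    gaps n L ∷ʳ gap n (lastOf n (es ∷ʳ b)) n        ≡⟨ cong (λ x → gaps n L ∷ʳ gap n x n) (lastOf-∷ʳ n es b) ⟩
    gaps n L ∷ʳ gap n b n                           ≡⟨ cong (gaps n L ∷ʳ_) (gap-< b<n) ⟩
    gaps n L ∷ʳ (n ∸ b)                             ∎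
    where open ≡-Reasoning

  gaps-τ : gaps n (n ∷ τ n ξ) ≡ (n ∸ b) ∷ gaps n L
  gaps-τ = begin
    gaps n (n ∷ τ n ξ)                          ≡⟨ cong (λ ys → gaps n (n ∷ ys)) τ-ξ ⟩
    gaps n (n ∷ map (cyc^ n (n ∸ b)) L)         ≡⟨ cong (λ x → gaps n (x ∷ map (cyc^ n (n ∸ b)) L)) cyc^-b ⟨
    gaps n (map (cyc^ n (n ∸ b)) (b ∷ L))       ≡⟨ gaps-map-cyc^ (n ∸ b) (b∈ ∷ L∈) (b≢n ∷ AllPairs⇒Linked distinct) ⟩
    gaps n (b ∷ L)                              ≡⟨ cong (_∷ gaps n L) (gap-< b<n) ⟩
    (n ∸ b) ∷ gaps n L                          ∎
    where open ≡-Reasoning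

  sum-gaps-τ : sum (gaps n (n ∷ τ n ξ)) ≡ sum (gaps n (n ∷ ξ))
  sum-gaps-τ = begin
    sum (gaps n (n ∷ τ n ξ))   ≡⟨ cong sum gaps-τ ⟩
    n ∸ b + sum (gaps n L)     ≡⟨ +-comm (n ∸ b) _ ⟩
    sum (gaps n L) + (n ∸ b)   ≡⟨ cong (sum (gaps n L) +_) (+-identityʳ (n ∸ b)) ⟨
    sum (gaps n L) + sum ((n ∸ b) ∷ []) ≡⟨ sum-++ (gaps n L) _ ⟨
    sum (gaps n L ∷ʳ (n ∸ b))  ≡⟨ cong sum gaps-ξ ⟨
    sum (gaps n (n ∷ ξ))       ∎
    where open ≡-Reasoning

  module _ (length≡n : suc (suc (length es)) ≡ n) where

    weightedSum-τ : n * (n ∸ secondLast ξ) + weightedSum (gaps n (n ∷ ξ))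
                  ≡ sum (gaps n (n ∷ ξ)) + weightedSum (gaps n (n ∷ τ n ξ))
    weightedSum-τ = begin
      n * (n ∸ secondLast ξ) + weightedSum (gaps n (n ∷ ξ))
        ≡⟨ cong₂ (λ s g → n * (n ∸ s) + weightedSum g) secondLast-ξ gaps-ξ ⟩
      n * (n ∸ b) + weightedSum (gaps n L ∷ʳ (n ∸ b))
        ≡⟨ cong (λ m → m * (n ∸ b) + weightedSum (gaps n L ∷ʳ (n ∸ b))) length-gaps-L ⟨
      suc (length (gaps n L)) * (n ∸ b) + weightedSum (gaps n L ∷ʳ (n ∸ b))
        ≡⟨ weightedSum-rotate (gaps n L) (n ∸ b) ⟩
      sum (gaps n L ∷ʳ (n ∸ b)) + weightedSum ((n ∸ b) ∷ gaps n L)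
        ≡⟨ cong₂ (λ g h → sum g + weightedSum h) gaps-ξ gaps-τ ⟨
      sum (gaps n (n ∷ ξ)) + weightedSum (gaps n (n ∷ τ n ξ)) ∎
      where
      open ≡-Reasoning
      length-gaps-L : suc (length (gaps n L)) ≡ n
      length-gaps-L = trans (cong suc (trans (length-gaps n (es ∷ʳ b)) (length-∷ʳ es b))) length≡n

    sum-gaps-ξ : sum (gaps n (n ∷ ξ)) ≡ n * (n ∸ asc ξ)
    sum-gaps-ξ = sum-gaps-closed n ξ (All.∷ʳ⁺ (All.map proj₂ inRange) ≤-refl) (lastOf-∷ʳ n (es ∷ʳ b) n)
      (trans (length-∷ʳ (es ∷ʳ b) n) (trans (cong suc (length-∷ʳ es b)) length≡n))

module _ {f g : List ℕ → List ℕ} {x : List ℕ} (T : ℕ → ℕ) {e : ℕ} (0<e : 0 < e)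
         (f^T≡g^ : ∀ j → iter f (T j) x ≡ iter g j x)
         (f-returns-at-T : ∀ t → iter f t x ≡ x → ∃ λ j → T j ≡ t)
         (T-at-g-returns : ∀ j → iter g j x ≡ x → T j ≡ j * e) where

  private instance
    e≢0 : NonZero e
    e≢0 = >-nonZero 0<e

  g-return⇒f-return : ∀ j → iter g j x ≡ x → iter f (j * e) x ≡ x
  g-return⇒f-return j g^j =
    subst (λ t → iter f t x ≡ x) (T-at-g-returns j g^j) (trans (f^T≡g^ j) g^j)

  f-return⇒g-return : ∀ t → iter f t x ≡ x → ∃ λ j → j * e ≡ t × iter g j x ≡ x
  f-return⇒g-return t f^t with f-returns-at-T t f^t
  ... | j , Tj≡t = j , trans (sym (T-at-g-returns j g^j)) Tj≡t , g^j
    where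
    g^j : iter g j x ≡ x
    g^j = trans (sym (f^T≡g^ j)) (trans (cong (λ s → iter f s x) Tj≡t) f^t)

  period-correspondence : ∀ d → IsPeriod g x d ⇔ IsPeriod f x (d * e)
  period-correspondence d = mk⇔ to from
    where
    to : IsPeriod g x d → IsPeriod f x (d * e)
    to (0<d , g^d , g-minimal) = *-monoˡ-< e 0<d , g-return⇒f-return d g^d , f-minimal
      where
      f-minimal : ∀ m → 0 < m → m < d * e → ¬ iter f m x ≡ x
      f-minimal m 0<m m<de f^m with f-return⇒g-return m f^m
      ... | j , je≡m , g^j = g-minimal j
        (*-cancelʳ-< e 0 j (subst (0 <_) (sym je≡m) 0<m))
        (*-cancelʳ-< e j d (subst (_< d * e) (sym je≡m) m<de)) g^j
    from : IsPeriod f x (d * e) → IsPeriod g x d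
    from (0<de , f^de , f-minimal) with f-return⇒g-return (d * e) f^de
    ... | j , je≡de , g^j = *-cancelʳ-< e 0 d 0<de , subst (λ i → iter g i x ≡ x) j≡d g^j , g-minimal
      where
      j≡d : j ≡ d
      j≡d = *-cancelʳ-≡ j d e je≡de
      g-minimal : ∀ m → 0 < m → m < d → ¬ iter g m x ≡ x
      g-minimal m 0<m m<d g^m =
        f-minimal (m * e) (*-monoˡ-< e 0<m) (*-monoˡ-< e m<d) (g-return⇒f-return m g^m)

-- Returns to canonical permutations

module Returns {n : ℕ} where

  step : List ℕ → ℕ
  step ξ = n ∸ secondLast ξ

  returnTime : List ℕ → ℕ → ℕ
  returnTime ξ zero    = 0
  returnTime ξ (suc j) = step (iter (τ n) j ξ) + returnTime ξ j

  gapSum : List ℕ → ℕ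
  gapSum ξ = sum (gaps n (n ∷ ξ))

  potential : List ℕ → ℕ
  potential ξ = weightedSum (gaps n (n ∷ ξ))

  module _ {ξ : List ℕ} where

    canonical-positive : Canonical n ξ → 0 < n
    canonical-positive (canonical _ _ len _ _) = subst (0 <_) len (s≤s z≤n)

    lastIs-canonical : Canonical n ξ → lastIs n ξ ≡ true
    lastIs-canonical (canonical _ _ _ d r) = Orbit.lastIs-ξ d r

    τ-canonical : Canonical n ξ → Canonical n (τ n ξ)
    τ-canonical (canonical _ _ len d r) = Orbit.τ-canonical d r len

    step-positive : Canonical n ξ → 0 < step ξ
    step-positive (canonical es b _ d r) =
      subst (λ s → 0 < n ∸ s) (sym (Orbit.secondLast-ξ d r)) (m<n⇒0<n∸m (Orbit.b<n d r))

    lastIs-within-step : Canonical n ξ → ∀ {m} → 0 < m → m < step ξ → lastIs n (iter (σ n) m ξ) ≡ false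
    lastIs-within-step (canonical es b _ d r) 0<m m<step =
      Orbit.lastIs-σ^-ξ d r _ 0<m (subst (λ s → _ < n ∸ s) (Orbit.secondLast-ξ d r) m<step)

    gapSum-τ : Canonical n ξ → gapSum (τ n ξ) ≡ gapSum ξ
    gapSum-τ (canonical _ _ _ d r) = Orbit.sum-gaps-τ d r

    potential-τ : Canonical n ξ → n * step ξ + potential ξ ≡ gapSum ξ + potential (τ n ξ)
    potential-τ (canonical _ _ len d r) = Orbit.weightedSum-τ d r len

    gapSum-canonical : Canonical n ξ → gapSum ξ ≡ n * (n ∸ asc ξ)
    gapSum-canonical (canonical _ _ len d r) = Orbit.sum-gaps-ξ d r len

  module _ {ξ : List ℕ} (ξ-canonical : Canonical n ξ) where

    iter-τ-canonical : ∀ j → Canonical n (iter (τ n) j ξ)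
    iter-τ-canonical zero    = ξ-canonical
    iter-τ-canonical (suc j) = τ-canonical (iter-τ-canonical j)

    gapSum-iter-τ : ∀ j → gapSum (iter (τ n) j ξ) ≡ gapSum ξ
    gapSum-iter-τ zero    = refl
    gapSum-iter-τ (suc j) = trans (gapSum-τ (iter-τ-canonical j)) (gapSum-iter-τ j)

    iter-σ-returnTime : ∀ j → iter (σ n) (returnTime ξ j) ξ ≡ iter (τ n) j ξ
    iter-σ-returnTime zero    = refl
    iter-σ-returnTime (suc j) = trans (iter-+ (σ n) (step ξⱼ) (returnTime ξ j) ξ)
                                     (cong (iter (σ n) (step ξⱼ)) (iter-σ-returnTime j))
      where ξⱼ = iter (τ n) j ξ

    potential-returnTime : ∀ j → n * returnTime ξ j + potential ξ
                                ≡ j * gapSum ξ + potential (iter (τ n) j ξ)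
    potential-returnTime zero    = cong (_+ potential ξ) (*-zeroʳ n)
    potential-returnTime (suc j) = begin
      n * (s + T) + P            ≡⟨ regroup n s T P ⟩
      n * s + (n * T + P)        ≡⟨ cong (n * s +_) (potential-returnTime j) ⟩
      n * s + (j * S + Pⱼ)       ≡⟨ m+[n+o]≡n+[m+o] (n * s) (j * S) Pⱼ ⟩
      j * S + (n * s + Pⱼ)       ≡⟨ cong (j * S +_) (potential-τ (iter-τ-canonical j)) ⟩
      j * S + (gapSum ξⱼ + P′)   ≡⟨ cong (λ z → j * S + (z + P′)) (gapSum-iter-τ j) ⟩
      j * S + (S + P′)           ≡⟨ m+[n+o]≡n+[m+o] (j * S) S P′ ⟩
      S + (j * S + P′)           ≡⟨ +-assoc S (j * S) P′ ⟨
      suc j * S + P′             ∎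
      where
      open ≡-Reasoning
      ξⱼ = iter (τ n) j ξ
      s = step ξⱼ
      T = returnTime ξ j
      S = gapSum ξ
      P = potential ξ
      Pⱼ = potential ξⱼ
      P′ = potential (τ n ξⱼ)
      regroup : ∀ n s T P → n * (s + T) + P ≡ n * s + (n * T + P)
      regroup = solve-∀

    returnTime-at-τ-return : ∀ j → iter (τ n) j ξ ≡ ξ → returnTime ξ j ≡ j * (n ∸ asc ξ)
    returnTime-at-τ-return j τ^j = *-cancelˡ-≡ _ _ n ⦃ >-nonZero (canonical-positive ξ-canonical) ⦄ (begin
      n * returnTime ξ j   ≡⟨ +-cancelʳ-≡ (potential ξ) _ _ potential-balance ⟩
      j * gapSum ξ         ≡⟨ cong (j *_) (gapSum-canonical ξ-canonical) ⟩
      j * (n * (n ∸ asc ξ)) ≡⟨ m*[n*o]≡n*[m*o] j n (n ∸ asc ξ) ⟩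
      n * (j * (n ∸ asc ξ)) ∎)
      where
      open ≡-Reasoning
      potential-balance : n * returnTime ξ j + potential ξ ≡ j * gapSum ξ + potential ξ
      potential-balance = trans (potential-returnTime j) (cong (λ z → j * gapSum ξ + potential z) τ^j)

    returnTime-bracket : ∀ t → ∃ λ j → returnTime ξ j ≤ t × t < returnTime ξ (suc j)
    returnTime-bracket zero = 0 , z≤n , <-≤-trans (step-positive ξ-canonical) (m≤m+n _ 0)
    returnTime-bracket (suc t) with returnTime-bracket t
    ... | j , Tⱼ≤t , t<Tⱼ₊₁ with m≤n⇒m<n∨m≡n t<Tⱼ₊₁
    ... | inj₁ 1+t<Tⱼ₊₁ = j , m≤n⇒m≤1+n Tⱼ≤t , 1+t<Tⱼ₊₁
    ... | inj₂ 1+t≡Tⱼ₊₁ = suc j , ≤-reflexive (sym 1+t≡Tⱼ₊₁) ,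
      subst (_< returnTime ξ (suc (suc j))) (sym 1+t≡Tⱼ₊₁)
            (m<n+m (returnTime ξ (suc j)) (step-positive (iter-τ-canonical (suc j))))

    canonical-only-at-returns : ∀ t → lastIs n (iter (σ n) t ξ) ≡ true → ∃ λ j → returnTime ξ j ≡ t
    canonical-only-at-returns t last≡n with returnTime-bracket t
    ... | j , Tⱼ≤t , t<Tⱼ₊₁ with m≤n⇒m<n∨m≡n Tⱼ≤t
    ... | inj₂ Tⱼ≡t = j , Tⱼ≡t
    ... | inj₁ Tⱼ<t = contradiction (trans (sym last≢n) last≡n) λ ()
      where
      open ≡-Reasoning
      ξⱼ = iter (τ n) j ξ
      Tⱼ = returnTime ξ j
      σ^t : iter (σ n) t ξ ≡ iter (σ n) (t ∸ Tⱼ) ξⱼ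
      σ^t = begin
        iter (σ n) t ξ                        ≡⟨ cong (λ s → iter (σ n) s ξ) (m∸n+n≡m Tⱼ≤t) ⟨
        iter (σ n) (t ∸ Tⱼ + Tⱼ) ξ            ≡⟨ iter-+ (σ n) (t ∸ Tⱼ) Tⱼ ξ ⟩
        iter (σ n) (t ∸ Tⱼ) (iter (σ n) Tⱼ ξ) ≡⟨ cong (iter (σ n) (t ∸ Tⱼ)) (iter-σ-returnTime j) ⟩
        iter (σ n) (t ∸ Tⱼ) ξⱼ                ∎
      t-Tⱼ<step : t ∸ Tⱼ < step ξⱼ
      t-Tⱼ<step = subst (t ∸ Tⱼ <_) (m+n∸n≡m (step ξⱼ) Tⱼ) (∸-monoˡ-< t<Tⱼ₊₁ Tⱼ≤t)
      last≢n : lastIs n (iter (σ n) t ξ) ≡ false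
      last≢n = trans (cong (lastIs n) σ^t)
        (lastIs-within-step (iter-τ-canonical j) (m<n⇒0<n∸m Tⱼ<t) t-Tⱼ<step)

    τ-period⇔σ-period : 0 < n ∸ asc ξ → ∀ d → IsPeriod (τ n) ξ d ⇔ IsPeriod (σ n) ξ (d * (n ∸ asc ξ))
    τ-period⇔σ-period 0<e = period-correspondence (returnTime ξ) 0<e iter-σ-returnTime
      (λ t σ^t → canonical-only-at-returns t (trans (cong (lastIs n) σ^t) (lastIs-canonical ξ-canonical)))
      returnTime-at-τ-return

module _ {n : ℕ} {xs : List ℕ} (perm : IsPerm n xs) where

  permutation-length : length xs ≡ n
  permutation-length = trans (↭-length perm) (trans (length-map suc (upTo n)) (length-upTo n))

  permutation-distinct : AllPairs _≢_ xs
  permutation-distinct = distinct-resp-↭ (↭-sym perm) (Unique.map⁺ suc-injective (Unique.upTo⁺ n))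

  permutation-inRange : All (InRange n) xs
  permutation-inRange = All-resp-↭ (↭-sym perm) (All.map⁺ (All.tabulate (λ i∈ → s≤s z≤n , ∈-upTo⁻ i∈)))

canonical-permutation : ∀ {n} as → 1 < n → IsPerm n (as ∷ʳ n) → Canonical n (as ∷ʳ n)
canonical-permutation {n} as 1<n perm with initLast as
... | []       = contradiction (permutation-length perm) (<⇒≢ 1<n)
... | es ∷ʳ′ b = canonical es b length≡n
  (distinct-resp-↭ (↭-sym (∷↭∷ʳ n (es ∷ʳ b))) (permutation-distinct perm))
  (proj₁ (All.∷ʳ⁻ (permutation-inRange perm)))
  where
  length≡n : suc (suc (length es)) ≡ n
  length≡n = trans (cong suc (sym (length-∷ʳ es b)))
                   (trans (sym (length-∷ʳ (es ∷ʳ b) n)) (permutation-length perm))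

theorem6 : (n k d : ℕ) (ξ : List ℕ) →
    2 ∣ n → 0 < n → k ≤ n ∸ 1 →
    IsPerm n ξ → ParityAlternating ξ → asc ξ ≡ k →
    (∃ λ as → ξ ≡ as ++ (n ∷ [])) →
    0 < d →
    (IsPeriod (τ n) ξ d ⇔ IsPeriod (σ n) ξ (d * (n ∸ k)))
theorem6 n k d ξ 2∣n 0<n k≤n-1 perm _ refl (as , refl) _ =
  Returns.τ-period⇔σ-period (canonical-permutation as 1<n perm) 0<n-k d
  where
  instance
    n≢0 : NonZero n
    n≢0 = >-nonZero 0<n
  1<n : 1 < n
  1<n = ∣⇒≤ 2∣n
  0<n-k : 0 < n ∸ k
  0<n-k = m<n⇒0<n∸m (m≤pred[n]⇒suc[m]≤n k≤n-1)
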